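{- Let $\phi$ be an unsatisfiable linear $r$-CNF formula. If there is a $(k+r-1)$-winning strategy for $\phi$, then every $\mathrm{Res}(\oplus)$ refutation of $\phi$ that uses only syntactic derivation rules has space at least $k$.
   Context: Linear clauses are disjunctions of linear literals $f=\alpha$ ($f$ a linear form over $\mathbb{F}_2$, $\alpha\in\{0,1\}$); a linear $r$-CNF is a conjunction of linear clauses each with at most $r$ linear literals. The syntactic derivation rules are: resolution (from $A\lor(f=0)$ and $B\lor(f=1)$ derive $A\lor B$); simplification (from $D\lor(0=1)$ derive $D$); syntactic weakening (from $D$ derive $D\lor(f=\alpha)$); addition (from $D\lor(f_1=\alpha_1)\lor(f_2=\alpha_2)$ derive $D\lor(f_1=\alpha_1)\lor(f_1+f_2=\alpha_1+\alpha_2+1)$). A refutation is a sequence of configurations (sets of linear clauses) $S_1=\emptyset,\dots,S_m$ with $S_m$ containing the empty clause, each obtained from the previous by download (add a clause of $\phi$), erasure (remove a clause), or inference (add a clause derived by a rule from clauses in the current configuration); its space is $\max_i|S_i|$. For linear systems, $|\mathcal{F}|$ is the number of equations and $\mathcal{F}\vDash\mathcal{G}$ means every solution of $\mathcal{F}$ solves $\mathcal{G}$. A non-empty family $\mathcal{H}$ of linear systems over $\mathbb{F}_2$ in the variables of $\phi$ is a $K$-winning strategy if: (1) every $\mathcal{F}\in\mathcal{H}$ has $|\mathcal{F}|\le K$; (2) for every $\mathcal{F}\in\mathcal{H}$ and every clause $C$ of $\phi$ some solution of $\mathcal{F}$ satisfies $C$; (3) if $|\mathcal{G}|\le K$ and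 $\mathcal{F}\vDash\mathcal{G}$ for some $\mathcal{F}\in\mathcal{H}$, then $\mathcal{G}\in\mathcal{H}$; (4) for every $\mathcal{F}\in\mathcal{H}$ with $|\mathcal{F}|<K$ and every linear form $f$ there is $a\in\mathbb{F}_2$ with $\mathcal{F}\land(f=a)\in\mathcal{H}$. -}

module Defs where

open import Data.Nat using (ℕ; _⊔_; _≤_; _<_)
open import Data.Bool using (Bool; true; false; _xor_; _∧_; not)
open import Data.Vec using (Vec; replicate; zipWith; foldr)
open import Data.List using (List; []; _∷_; _++_; length)
open import Data.List.Membership.Propositional using (_∈_)
open import Data.List.Relation.Unary.All using (All)
open import Data.List.Relation.Binary.BagAndSetEquality using (_∼[_]_; set)
open import Data.Product using (Σ; ∃; _×_; _,_)
open import Relation.Binary.PropositionalEquality using (_≡_)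
open import Relation.Nullary using (¬_)

-- Linear forms over F₂ in n variables: coefficient vectors (homogeneous).
LinForm : ℕ → Set
LinForm n = Vec Bool n

zeroForm : ∀ {n} → LinForm n
zeroForm = replicate _ false

_⊕_ : ∀ {n} → LinForm n → LinForm n → LinForm n
_⊕_ = zipWith _xor_

Assignment : ℕ → Set
Assignment n = Vec Bool n

eval : ∀ {n} → LinForm n → Assignment n → Bool
eval f x = foldr _ _xor_ false (zipWith _∧_ f x)

-- linear literal  f = α   (also used as a linear equation)
Literal : ℕ → Set
Literal n = LinForm n × Bool

-- a linear clause: disjunction of literals; a list, considered up to
-- set equality (_∼[ set ]_) wherever it matters
Clause : ℕ → Set
Clause n = List (Literal n)

CNF : ℕ → Set
CNF n = List (Clause n)

SatLit : ∀ {n} → Assignment n → Literal n → Set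
SatLit x (f , α) = eval f x ≡ α

SatClause : ∀ {n} → Assignment n → Clause n → Set
SatClause x C = ∃ λ l → l ∈ C × SatLit x l

Unsatisfiable : ∀ {n} → CNF n → Set
Unsatisfiable φ = ∀ x → ¬ All (SatClause x) φ

WidthAtMost : ∀ {n} → ℕ → Clause n → Set
WidthAtMost r C = ∃ λ L → L ∼[ set ] C × length L ≤ r

IsLinearRCNF : ∀ {n} → ℕ → CNF n → Set
IsLinearRCNF r φ = All (WidthAtMost r) φ

data Resolution {n} (C₁ C₂ C : Clause n) : Set where
  res : ∀ f A B → C₁ ∼[ set ] ((f , false) ∷ A) → C₂ ∼[ set ] ((f , true) ∷ B)
      → C ∼[ set ] (A ++ B) → Resolution C₁ C₂ C

data Simplification {n} (C₁ C : Clause n) : Set where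
  simp : ∀ D → C₁ ∼[ set ] ((zeroForm , true) ∷ D) → C ∼[ set ] D
       → Simplification C₁ C

data Weakening {n} (C₁ C : Clause n) : Set where
  weak : ∀ f α → C ∼[ set ] ((f , α) ∷ C₁) → Weakening C₁ C

data Addition {n} (C₁ C : Clause n) : Set where
  add : ∀ f₁ α₁ f₂ α₂ D → C₁ ∼[ set ] ((f₁ , α₁) ∷ (f₂ , α₂) ∷ D)
      → C ∼[ set ] ((f₁ , α₁) ∷ (f₁ ⊕ f₂ , not (α₁ xor α₂)) ∷ D)
      → Addition C₁ C

data Infers {n} (S : List (Clause n)) (C : Clause n) : Set where
  by-res  : ∀ {C₁ C₂} → C₁ ∈ S → C₂ ∈ S → Resolution C₁ C₂ C → Infers S C
  by-simp : ∀ {C₁} → C₁ ∈ S → Simplification C₁ C → Infers S C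
  by-weak : ∀ {C₁} → C₁ ∈ S → Weakening C₁ C → Infers S C
  by-add  : ∀ {C₁} → C₁ ∈ S → Addition C₁ C → Infers S C

Config : ℕ → Set
Config n = List (Clause n)

data Step {n} (φ : CNF n) : Config n → Config n → Set where
  download : ∀ {S C D} → D ∈ φ → C ∼[ set ] D → Step φ S (C ∷ S)
  erasure  : ∀ xs C ys → Step φ (xs ++ C ∷ ys) (xs ++ ys)
  infer    : ∀ {S C} → Infers S C → Step φ S (C ∷ S)

data Derivation {n} (φ : CNF n) : Config n → Set where
  done : ∀ {S} → [] ∈ S → Derivation φ S
  step : ∀ {S S'} → Step φ S S' → Derivation φ S' → Derivation φ S

space : ∀ {n} {φ : CNF n} {S} → Derivation φ S → ℕ
space (done {S} _) = length S
space (step {S} _ d) = length S ⊔ space d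

Refutation : ∀ {n} → CNF n → Set
Refutation φ = Derivation φ []

LinSystem : ℕ → Set
LinSystem n = List (Literal n)

Solves : ∀ {n} → Assignment n → LinSystem n → Set
Solves x F = All (SatLit x) F

_⊨_ : ∀ {n} → LinSystem n → LinSystem n → Set
F ⊨ G = ∀ x → Solves x F → Solves x G

record WinningStrategy {n} (K : ℕ) (φ : CNF n) (H : LinSystem n → Set) : Set where
  field
    nonEmpty  : ∃ λ F → H F
    bounded   : ∀ F → H F → length F ≤ K
    consistent : ∀ F → H F → ∀ C → C ∈ φ → ∃ λ x → Solves x F × SatClause x C
    closed    : ∀ F G → H F → length G ≤ K → F ⊨ G → H G
    extend    : ∀ F → H F → length F < K → ∀ (f : LinForm n) → ∃ λ a → H ((f , a) ∷ F)

-- Suppose a refutation had space < k.  Along it, keep a system F ∈ H consisting of one literal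
-- chosen from each clause of the current configuration; since every system in H is satisfiable,
-- the empty clause can never appear.  Erasing a clause drops its literal (H is closed under
-- implied subsystems).  The chosen literals of the premises of a resolution or simplification step
-- hold under a common solution of F, so they are not the literals that the rule removes and survive
-- into the conclusion; weakening keeps every literal.  Addition only destroys the literal f₂ = α₂;
-- extending F by a value of f₁ makes either f₁ = α₁ or f₁ + f₂ = α₁ + α₂ + 1 a consequence.  For a
-- downloaded clause of width ≤ r, first extend F to fix all of its ≤ r linear forms (the budget
-- k + r − 1 allows this); property (2) of H then yields a solution satisfying some literal, and as its
-- form is fixed, that literal is implied by the extension.
module Submission where

open import Defs
open import Data.Nat using (ℕ; _+_; _∸_; _≤_)
open import Data.Product using (∃)

open import Algebra.Bundles using (CommutativeRing)
open import Data.Bool using (false; not; _∧_; _xor_)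
open import Data.Bool.Properties
  using (∧-distribʳ-xor; xor-∧-commutativeRing; ¬-not; not-distribˡ-xor)
  renaming (_≟_ to _≟ᵇ_)
open import Algebra.Properties.CommutativeSemigroup
  (CommutativeRing.+-commutativeSemigroup xor-∧-commutativeRing)
  using (interchange)
open import Data.Empty using (⊥; ⊥-elim)
open import Data.List using (List; []; _∷_; _++_; length)
open import Data.List.Membership.Propositional using (_∈_)
open import Data.List.Membership.Propositional.Properties using (∈-++⁺ˡ; ∈-++⁺ʳ)
open import Data.List.Relation.Binary.Pointwise using (Pointwise; []; _∷_; Pointwise-length)
open import Data.List.Relation.Binary.Subset.Propositional using (_⊆_)
open import Data.List.Relation.Binary.Subset.Propositional.Properties
  using (⊆-refl; xs⊆x∷xs; ++⁺ʳ; ∈-∷⁺ʳ)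
open import Data.List.Relation.Unary.All as All using (All; []; _∷_)
open import Data.List.Relation.Unary.All.Properties using (anti-mono)
open import Data.List.Relation.Unary.Any using (here; there)
open import Data.Nat using (suc; _<_; s≤s; z≤n)
open import Data.Nat.Properties
  using (≤-refl; ≤-trans; ≤-<-trans; m≤m+n; +-suc; +-monoʳ-≤; +-monoˡ-≤; m≤n⇒m≤n+o; <⇒≤;
         n≤1+n; m≤m⊔n; m⊔n<o⇒n<o; ≮⇒≥)
open import Data.Product using (_×_; _,_; proj₁; proj₂)
open import Data.Sum using (_⊎_; inj₁; inj₂)
open import Data.Vec using ([]; _∷_; replicate)
open import Function.Base using (_∘_)
open import Function.Bundles using (Equivalence)
open import Relation.Binary.PropositionalEquality
open import Relation.Nullary using (yes; no)

module _ {a b ℓ} {A : Set a} {B : Set b} {R : A → B → Set ℓ} where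

  Pointwise-∈ : ∀ {xs ys x} → Pointwise R xs ys → x ∈ xs → ∃ λ y → R x y × y ∈ ys
  Pointwise-∈ (Rxy ∷ _)  (here refl) = _ , Rxy , here refl
  Pointwise-∈ (_ ∷ Rxsys) (there x∈xs) with Pointwise-∈ Rxsys x∈xs
  ... | y , Rxy , y∈ys = y , Rxy , there y∈ys

  Pointwise-remove : ∀ xs {x ys zs} → Pointwise R (xs ++ x ∷ ys) zs →
    ∃ λ ws → ∃ λ z → ∃ λ vs → zs ≡ ws ++ z ∷ vs × Pointwise R (xs ++ ys) (ws ++ vs)
  Pointwise-remove []       (_ ∷ Rys)   = [] , _ , _ , refl , Rys
  Pointwise-remove (_ ∷ xs) (Rxw ∷ Rxs) with Pointwise-remove xs Rxs
  ... | ws , z , vs , refl , Rrest = _ ∷ ws , z , vs , refl , Rxw ∷ Rrest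

length-++-∷ : ∀ {a} {A : Set a} (xs : List A) {y} ys → length (xs ++ ys) ≤ length (xs ++ y ∷ ys)
length-++-∷ []       ys = n≤1+n (length ys)
length-++-∷ (_ ∷ xs) ys = s≤s (length-++-∷ xs ys)

private variable n : ℕ

eval-zeroForm : (x : Assignment n) → eval zeroForm x ≡ false
eval-zeroForm []      = refl
eval-zeroForm (_ ∷ x) = eval-zeroForm x

eval-⊕ : (f g : LinForm n) (x : Assignment n) → eval (f ⊕ g) x ≡ eval f x xor eval g x
eval-⊕ []      []      []      = refl
eval-⊕ (a ∷ f) (b ∷ g) (c ∷ x) = begin
  ((a xor b) ∧ c) xor eval (f ⊕ g) x
    ≡⟨ cong₂ _xor_ (∧-distribʳ-xor c a b) (eval-⊕ f g x) ⟩
  ((a ∧ c) xor (b ∧ c)) xor (eval f x xor eval g x)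
    ≡⟨ interchange (a ∧ c) (b ∧ c) (eval f x) (eval g x) ⟩
  ((a ∧ c) xor eval f x) xor ((b ∧ c) xor eval g x) ∎
  where open ≡-Reasoning

⊕-satisfied : ∀ {x : Assignment n} f₁ α₁ f₂ α₂ → eval f₁ x ≡ not α₁ → eval f₂ x ≡ α₂ →
  eval (f₁ ⊕ f₂) x ≡ not (α₁ xor α₂)
⊕-satisfied {x = x} f₁ α₁ f₂ α₂ f₁≡ f₂≡ = begin
  eval (f₁ ⊕ f₂) x      ≡⟨ eval-⊕ f₁ f₂ x ⟩
  eval f₁ x xor eval f₂ x ≡⟨ cong₂ _xor_ f₁≡ f₂≡ ⟩
  not α₁ xor α₂         ≡⟨ sym (not-distribˡ-xor α₁ α₂) ⟩
  not (α₁ xor α₂)       ∎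
  where open ≡-Reasoning

⊆⇒⊨ : {F G : LinSystem n} → G ⊆ F → F ⊨ G
⊆⇒⊨ G⊆F _ = anti-mono G⊆F

Determines : LinSystem n → LinForm n → Set
Determines F f = ∀ {x y} → Solves x F → Solves y F → eval f x ≡ eval f y

weakening-keeps : {C₁ C : Clause n} {l : Literal n} → Weakening C₁ C → l ∈ C₁ → l ∈ C
weakening-keeps (weak _ _ C∼) l∈C₁ = Equivalence.from C∼ (there l∈C₁)

simplification-keeps : {C₁ C : Clause n} {l : Literal n} {x : Assignment n} →
  Simplification C₁ C → l ∈ C₁ → SatLit x l → l ∈ C
simplification-keeps {x = x} (simp D C₁∼ C∼) l∈C₁ sat with Equivalence.to C₁∼ l∈C₁
... | there l∈D = Equivalence.from C∼ l∈D
... | here refl with trans (sym (eval-zeroForm x)) sat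
... | ()

resolution-keeps : {C₁ C₂ C : Clause n} {l₁ l₂ : Literal n} {x : Assignment n} →
  Resolution C₁ C₂ C → l₁ ∈ C₁ → l₂ ∈ C₂ → SatLit x l₁ → SatLit x l₂ → l₁ ∈ C ⊎ l₂ ∈ C
resolution-keeps (res f A B C₁∼ C₂∼ C∼) l₁∈C₁ l₂∈C₂ sat₁ sat₂
  with Equivalence.to C₁∼ l₁∈C₁ | Equivalence.to C₂∼ l₂∈C₂
... | there l₁∈A | _          = inj₁ (Equivalence.from C∼ (∈-++⁺ˡ l₁∈A))
... | here refl  | there l₂∈B = inj₂ (Equivalence.from C∼ (∈-++⁺ʳ A l₂∈B))
... | here refl  | here refl  with trans (sym sat₁) sat₂
... | ()

Picks : Config n → LinSystem n → Set
Picks = Pointwise (λ C l → l ∈ C)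

unsatisfiable-nonempty : {φ : CNF n} → Unsatisfiable φ → ∃ λ C → C ∈ φ
unsatisfiable-nonempty {n} {[]}    unsat = ⊥-elim (unsat (replicate n false) [])
unsatisfiable-nonempty {φ = C ∷ _} _     = C , here refl

length≤space : {φ : CNF n} {S : Config n} (d : Derivation φ S) → length S ≤ space d
length≤space (done _)   = ≤-refl
length≤space (step _ d) = m≤m⊔n _ (space d)

module StrategyProperties {n K : ℕ} {φ : CNF n} {H : LinSystem n → Set}
                          (W : WinningStrategy K φ H) where
  open WinningStrategy W

  Extendable : LinSystem n → Clause n → Set
  Extendable F C = ∃ λ l → l ∈ C × H (l ∷ F)

  empty-system : H []
  empty-system = let F , h = nonEmpty in closed F [] h z≤n (λ _ _ → [])

  solvable : ∀ {C F} → C ∈ φ → H F → ∃ λ x → Solves x F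
  solvable C∈φ h = let x , sx , _ = consistent _ h _ C∈φ in x , sx

  closed-⊆ : ∀ {F G} → H F → G ⊆ F → length G ≤ K → H G
  closed-⊆ h G⊆F bound = closed _ _ h bound (⊆⇒⊨ G⊆F)

  extendable-by-chosen : ∀ {F C l} → H F → suc (length F) ≤ K → l ∈ F → l ∈ C → Extendable F C
  extendable-by-chosen h bound l∈F l∈C = _ , l∈C , closed-⊆ h (∈-∷⁺ʳ l∈F ⊆-refl) bound

  extend-determining : ∀ (L : List (Literal n)) {F} → H F → length F + length L ≤ K →
    ∃ λ F' → H F' × F' ⊨ F × All (λ l → Determines F' (proj₁ l)) L
  extend-determining []            h _     = _ , h , (λ _ sx → sx) , []
  extend-determining ((f , _) ∷ L) {F} h bound rewrite +-suc (length F) (length L)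
    with extend F h (≤-trans (s≤s (m≤m+n (length F) (length L))) bound) f
  ... | a , h₁ with extend-determining L h₁ bound
  ... | F' , h' , F'⊨ , dets = F' , h' , (λ x sx → All.tail (F'⊨ x sx)) , f-determined ∷ dets
    where f-determined : Determines F' f
          f-determined sx sy = trans (All.head (F'⊨ _ sx)) (sym (All.head (F'⊨ _ sy)))

  downloaded-extendable : ∀ {r D F} → D ∈ φ → WidthAtMost r D → H F →
    suc (length F) ≤ K → length F + r ≤ K → Extendable F D
  downloaded-extendable D∈φ (L , L∼D , |L|≤r) h bound₁ bound₂
    with extend-determining L h (≤-trans (+-monoʳ-≤ _ |L|≤r) bound₂)
  ... | F' , h' , F'⊨F , dets with consistent F' h' _ D∈φ
  ... | x , sx , l , l∈D , sat =
    l , l∈D , closed F' _ h' bound₁ (λ y sy → l-holds sy ∷ F'⊨F y sy)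
    where l-holds : ∀ {y} → Solves y F' → SatLit y l
          l-holds sy = trans (All.lookup dets (Equivalence.from L∼D l∈D) sy sx) sat

  added-extendable : ∀ {C₁ C F l} → Addition C₁ C → l ∈ C₁ → l ∈ F → H F →
    suc (length F) ≤ K → Extendable F C
  added-extendable {F = F} (add f₁ α₁ f₂ α₂ D C₁∼ C∼) l∈C₁ l∈F h bound
    with Equivalence.to C₁∼ l∈C₁
  ... | here refl         = extendable-by-chosen h bound l∈F (Equivalence.from C∼ (here refl))
  ... | there (there l∈D) =
    extendable-by-chosen h bound l∈F (Equivalence.from C∼ (there (there l∈D)))
  ... | there (here refl) with extend F h bound f₁
  ...   | a , h₁ with a ≟ᵇ α₁
  ...     | yes refl = _ , Equivalence.from C∼ (here refl) , h₁
  ...     | no a≢α₁  = _ , Equivalence.from C∼ (there (here refl)) ,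
                       closed _ _ h₁ bound (λ _ sx → sum-holds sx ∷ All.tail sx)
    where sum-holds : ∀ {x} → Solves x ((f₁ , a) ∷ F) → eval (f₁ ⊕ f₂) x ≡ not (α₁ xor α₂)
          sum-holds (f₁≡a ∷ sF) =
            ⊕-satisfied f₁ α₁ f₂ α₂ (trans f₁≡a (¬-not a≢α₁)) (All.lookup sF l∈F)

  inferred-extendable : ∀ {S F C} {x : Assignment n} → Solves x F → Picks S F → Infers S C →
    H F → suc (length F) ≤ K → Extendable F C
  inferred-extendable sx p (by-weak C₁∈S w) h bound with Pointwise-∈ p C₁∈S
  ... | _ , l∈C₁ , l∈F = extendable-by-chosen h bound l∈F (weakening-keeps w l∈C₁)
  inferred-extendable sx p (by-simp C₁∈S s) h bound with Pointwise-∈ p C₁∈S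
  ... | _ , l∈C₁ , l∈F =
    extendable-by-chosen h bound l∈F (simplification-keeps s l∈C₁ (All.lookup sx l∈F))
  inferred-extendable sx p (by-res C₁∈S C₂∈S r) h bound
    with Pointwise-∈ p C₁∈S | Pointwise-∈ p C₂∈S
  ... | _ , l₁∈C₁ , l₁∈F | _ , l₂∈C₂ , l₂∈F
    with resolution-keeps r l₁∈C₁ l₂∈C₂ (All.lookup sx l₁∈F) (All.lookup sx l₂∈F)
  ...   | inj₁ l₁∈C = extendable-by-chosen h bound l₁∈F l₁∈C
  ...   | inj₂ l₂∈C = extendable-by-chosen h bound l₂∈F l₂∈C
  inferred-extendable sx p (by-add C₁∈S a) h bound with Pointwise-∈ p C₁∈S
  ... | _ , l∈C₁ , l∈F = added-extendable a l∈C₁ l∈F h bound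

budget : ∀ {m k} r → suc m < k → suc m ≤ k + r ∸ 1 × m + r ≤ k + r ∸ 1
budget r (s≤s m<k) = m≤n⇒m≤n+o r m<k , +-monoˡ-≤ r (<⇒≤ m<k)

module _ {r k : ℕ} {φ : CNF n} (width : IsLinearRCNF r φ) (unsat : Unsatisfiable φ)
         {H : LinSystem n → Set} (W : WinningStrategy (k + r ∸ 1) φ H) where
  open WinningStrategy W using (bounded)
  open StrategyProperties W

  picks-budget : {S : Config n} {F : LinSystem n} → Picks S F → suc (length S) < k →
    suc (length F) ≤ k + r ∸ 1 × length F + r ≤ k + r ∸ 1
  picks-budget p = budget r ∘ subst (λ m → suc m < k) (Pointwise-length p)

  step-preserves-picks : ∀ {S S' F} → Step φ S S' → length S' < k → H F → Picks S F →
    ∃ λ F' → H F' × Picks S' F'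
  step-preserves-picks (download D∈φ C∼D) S'<k h p =
    let bound₁ , bound₂ = picks-budget p S'<k
        l , l∈D , h' = downloaded-extendable D∈φ (All.lookup width D∈φ) h bound₁ bound₂
    in _ , h' , Equivalence.from C∼D l∈D ∷ p
  step-preserves-picks (infer i) S'<k h p =
    let _ , sx = solvable (proj₂ (unsatisfiable-nonempty unsat)) h
        l , l∈C , h' = inferred-extendable sx p i h (proj₁ (picks-budget p S'<k))
    in _ , h' , l∈C ∷ p
  step-preserves-picks (erasure xs C ys) _ h p with Pointwise-remove xs p
  ... | Fx , l , Fy , refl , p' =
    _ , closed-⊆ h (++⁺ʳ Fx (xs⊆x∷xs Fy l)) (≤-trans (length-++-∷ Fx Fy) (bounded _ h)) , p'

  no-refutation-below-k : ∀ {S F} (d : Derivation φ S) → space d < k → H F → Picks S F → ⊥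
  no-refutation-below-k (done []∈S) _ _ p with Pointwise-∈ p []∈S
  ... | _ , () , _
  no-refutation-below-k (step {S} s d) space<k h p =
    let _ , h' , p' = step-preserves-picks s (≤-<-trans (length≤space d) space-d<k) h p
    in no-refutation-below-k d space-d<k h' p'
    where space-d<k : space d < k
          space-d<k = m⊔n<o⇒n<o (length S) (space d) space<k

lemma4p5 : (n r k : ℕ) (φ : CNF n) → IsLinearRCNF r φ → Unsatisfiable φ
    → (∃ λ H → WinningStrategy (k + r ∸ 1) φ H)
    → (π : Refutation φ) → k ≤ space π
lemma4p5 n r k φ width unsat (H , W) π =
  ≮⇒≥ λ space<k →
    no-refutation-below-k width unsat W π space<k (StrategyProperties.empty-system W) []
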